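{- Let $\Gamma$ be a group and let $C$ be a finite inclusion-minimal generating set of $\Gamma$. Then $$\chi(\mathrm{Cay}(\Gamma,C))\leq\max\{\chi(\mathrm{Cay}(\Gamma/\langle C\setminus\{c\} \rangle,\{c\}))\mid c \in C\}.$$
   Context: For a group $\Gamma$ and a subset $C\subseteq\Gamma$, the Cayley graph $\mathrm{Cay}(\Gamma,C)$ is the undirected graph with vertex set $\Gamma$ in which $a,b\in\Gamma$ are adjacent if $a^{ -1}b\in C$; it is undirected even if $C$ is not inverse-closed. For a subgroup $H\le\Gamma$ and $C\subseteq\Gamma$, the Schreier coset graph $\mathrm{Cay}(\Gamma/H,C)$ has as vertices the left cosets of $H$ in $\Gamma$, two cosets being adjacent if they can be written as $gH$ and $g'H$ with $g^{ -1}g'\in C$. $\chi$ denotes the chromatic number. -}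

module Defs where

open import Level using (Level; _⊔_; suc; Lift)
open import Algebra.Bundles using (Group)
open import Data.Nat using (ℕ)
open import Data.Fin using (Fin)
open import Data.Product using (Σ; ∃; _×_; _,_)
open import Data.Sum using (_⊎_)
open import Relation.Nullary using (¬_)
open import Relation.Binary.PropositionalEquality using (_≡_; _≢_)

module _ {a ℓ : Level} (G : Group a ℓ) where
  open Group G

  Subset : Set (suc (a ⊔ ℓ))
  Subset = Carrier → Set (a ⊔ ℓ)

  _⊆_ : Subset → Subset → Set (a ⊔ ℓ)
  S ⊆ T = ∀ x → S x → T x

  image : {n : ℕ} → (Fin n → Carrier) → Subset
  image f x = Lift (a ⊔ ℓ) (∃ λ i → x ≈ f i)

  remove : Subset → Carrier → Subset
  remove S c x = S x × (¬ (x ≈ c))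

  data Span (S : Subset) : Carrier → Set (a ⊔ ℓ) where
    gen  : ∀ {x} → S x → Span S x
    unit : Span S ε
    mul  : ∀ {x y} → Span S x → Span S y → Span S (x ∙ y)
    inv  : ∀ {x} → Span S x → Span S (x ⁻¹)
    resp : ∀ {x y} → x ≈ y → Span S x → Span S y

  Generates : Subset → Set (a ⊔ ℓ)
  Generates S = ∀ x → Span S x

  MinimalGenerating : Subset → Set (suc (a ⊔ ℓ))
  MinimalGenerating C =
    Generates C × (∀ (S : Subset) → S ⊆ C → Generates S → C ⊆ S)

  CayAdj : Subset → Carrier → Carrier → Set (a ⊔ ℓ)
  CayAdj C x y = C (x ⁻¹ ∙ y) ⊎ C (y ⁻¹ ∙ x)

  SameCoset : Subset → Carrier → Carrier → Set (a ⊔ ℓ)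
  SameCoset H g g' = H (g ⁻¹ ∙ g')

  -- Schreier coset graph Cay(Γ/H,C), with cosets represented by elements:
  -- gH ~ g'H iff they have representatives x ∈ gH, y ∈ g'H with
  -- x⁻¹y ∈ C (or y⁻¹x ∈ C, making the graph undirected).
  SchreierAdj : Subset → Subset → Carrier → Carrier → Set (a ⊔ ℓ)
  SchreierAdj H C g g' =
    Σ Carrier λ x → Σ Carrier λ y →
      SameCoset H g x × SameCoset H g' y × CayAdj C x y

  -- A proper k-colouring of a graph whose vertices are the classes of the
  -- equivalence E on Carrier, with adjacency A: a colouring of Carrier that
  -- is constant on E-classes and gives adjacent vertices different colours.
  Colorable : (Carrier → Carrier → Set (a ⊔ ℓ)) →
              (Carrier → Carrier → Set (a ⊔ ℓ)) → ℕ → Set (a ⊔ ℓ)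
  Colorable E A k =
    Σ (Carrier → Fin k) λ col →
      (∀ x y → E x y → col x ≡ col y) × (∀ x y → A x y → col x ≢ col y)

  CayColorable : Subset → ℕ → Set (a ⊔ ℓ)
  CayColorable C k = Colorable (λ x y → Lift (a ⊔ ℓ) (x ≈ y)) (CayAdj C) k

  SchreierColorable : Subset → Subset → ℕ → Set (a ⊔ ℓ)
  SchreierColorable H C k = Colorable (SameCoset H) (SchreierAdj H C) k

  singleton : Carrier → Subset
  singleton c x = Lift (a ⊔ ℓ) (x ≈ c)

-- Colour g by the sum, modulo k, of the colours of its cosets g⟨C ∖ {c}⟩ over c ∈ C.
-- Along an edge g — gc, every coset g⟨C ∖ {c'}⟩ with c' ≠ c is unchanged since c ∈ C ∖ {c'},
-- while g⟨C ∖ {c}⟩ and gc⟨C ∖ {c}⟩ are adjacent in Cay(Γ/⟨C ∖ {c}⟩, {c}) and so get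
-- different colours: exactly one summand changes, hence so does the sum.
module Submission where

open import Defs
open import Algebra.Bundles using (Group)
open import Data.Nat using (ℕ; _<_)
open import Data.Fin using (Fin)

open import Level using (lift)
open import Function using (_∘_)
open import Data.Nat as ℕ using (suc; _+_; _*_; _%_)
open import Data.Nat.Properties using (+-0-commutativeMonoid; *-suc; +-assoc)
open import Data.Nat.DivMod using (_mod_; [m+kn]%n≡m%n; %-distribˡ-+; m<n⇒m%n≡m)
open import Data.Fin as Fin using (zero; suc; Fin′; inject; lower; toℕ; fromℕ<; punchIn)
open import Data.Fin.Properties
  using (¬Fin0; toℕ-injective; toℕ<n; fromℕ<-injective; punchInᵢ≢i; <-cmp; all?; ¬∀⟶∃¬-smallest)
  renaming (_≟_ to _≟ᶠ_)
open import Data.Vec.Functional using (Vector; removeAt)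
open import Algebra.Properties.CommutativeMonoid.Sum +-0-commutativeMonoid
  using (sum; sum-remove; sum-cong-≗)
open import Data.Product using (∃; _×_; _,_; proj₁; proj₂)
open import Data.Sum using (inj₁; inj₂)
open import Data.Empty using (⊥-elim)
open import Relation.Nullary using (¬_; Dec; yes; no)
open import Relation.Nullary.Decidable using (decidable-stable)
open import Relation.Binary using (tri<; tri≈; tri>)
open import Relation.Binary.PropositionalEquality
  using (_≡_; _≢_; refl; sym; trans; cong; subst; module ≡-Reasoning)
import Algebra.Properties.Group as GroupProperties

open ≡-Reasoning

+-%-cancelʳ : ∀ m a b c → (a + c) % suc m ≡ (b + c) % suc m → a % suc m ≡ b % suc m
+-%-cancelʳ m a b c eq = begin
  a % n                          ≡⟨ shift a ⟩
  ((a + c) % n + c * m % n) % n  ≡⟨ cong (λ r → (r + c * m % n) % n) eq ⟩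
  ((b + c) % n + c * m % n) % n  ≡⟨ shift b ⟨
  b % n                          ∎
  where
  n = suc m
  -- adding c * m to x + c adds a multiple of n to x
  shift : ∀ x → x % n ≡ ((x + c) % n + c * m % n) % n
  shift x = begin
    x % n                          ≡⟨ [m+kn]%n≡m%n x c n ⟨
    (x + c * n) % n                ≡⟨ cong (λ r → (x + r) % n) (*-suc c m) ⟩
    (x + (c + c * m)) % n          ≡⟨ cong (_% n) (+-assoc x c (c * m)) ⟨
    (x + c + c * m) % n            ≡⟨ %-distribˡ-+ (x + c) (c * m) n ⟩
    ((x + c) % n + c * m % n) % n  ∎

sum-mod-≢ : ∀ {k n} (u v : Vector (Fin (suc k)) n) (j : Fin n) →
            u j ≢ v j → (∀ i → i ≢ j → u i ≡ v i) →
            sum (toℕ ∘ u) mod suc k ≢ sum (toℕ ∘ v) mod suc k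
sum-mod-≢ {n = ℕ.zero} _ _ ()
sum-mod-≢ {k} {suc _} u v j uj≢vj agree eq = uj≢vj (toℕ-injective (begin
  toℕ (u j)      ≡⟨ m<n⇒m%n≡m (toℕ<n (u j)) ⟨
  toℕ (u j) % K  ≡⟨ +-%-cancelʳ k (toℕ (u j)) (toℕ (v j)) (sum rest) sums-with-rest ⟩
  toℕ (v j) % K  ≡⟨ m<n⇒m%n≡m (toℕ<n (v j)) ⟩
  toℕ (v j)      ∎))
  where
  K = suc k
  rest = removeAt (toℕ ∘ u) j
  sums-with-rest : (toℕ (u j) + sum rest) % K ≡ (toℕ (v j) + sum rest) % K
  sums-with-rest = begin
    (toℕ (u j) + sum rest) % K                        ≡⟨ cong (_% K) (sum-remove (toℕ ∘ u)) ⟨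
    sum (toℕ ∘ u) % K                                 ≡⟨ fromℕ<-injective _ _ _ _ eq ⟩
    sum (toℕ ∘ v) % K                                 ≡⟨ cong (_% K) (sum-remove (toℕ ∘ v)) ⟩
    (toℕ (v j) + sum (removeAt (toℕ ∘ v) j)) % K      ≡⟨ cong (λ s → (toℕ (v j) + s) % K)
                                                           (sum-cong-≗ λ i → cong toℕ
                                                             (sym (agree (punchIn j i) (punchInᵢ≢i j i)))) ⟩
    (toℕ (v j) + sum rest) % K                        ∎

inject-lower : ∀ {n} {j : Fin n} (i : Fin n) (i<j : i Fin.< j) → inject {i = j} (lower i i<j) ≡ i
inject-lower {j = suc _} zero    _   = refl
inject-lower {j = suc _} (suc i) i<j = cong suc (inject-lower i (ℕ.s≤s⁻¹ i<j))

masked : ∀ {p} {P : Set p} {m} → Dec P → Fin (suc m) → Fin (suc m)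
masked (yes _) c = c
masked (no _)  _ = zero

masked-≡ : ∀ {p} {P : Set p} {m} {c c' : Fin (suc m)} (P? : Dec P) →
           (P → c ≡ c') → masked P? c ≡ masked P? c'
masked-≡ (yes p) c≡c' = c≡c' p
masked-≡ (no _)  _    = refl

masked-≢ : ∀ {p} {P : Set p} {m} {c c' : Fin (suc m)} (P? : Dec P) →
           P → c ≢ c' → masked P? c ≢ masked P? c'
masked-≢ (yes _) _ c≢c' = c≢c'
masked-≢ (no ¬p) p _    = ⊥-elim (¬p p)

module _ {a ℓ} (G : Group a ℓ) where
  open Group G renaming (refl to ≈-refl; sym to ≈-sym; trans to ≈-trans)
  open GroupProperties G using (ε⁻¹≈ε)

  ε⁻¹∙x≈x : ∀ x → ε ⁻¹ ∙ x ≈ x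
  ε⁻¹∙x≈x x = ≈-trans (∙-congʳ ε⁻¹≈ε) (identityˡ x)

  ≈⇒sameCoset : ∀ {S x y} → x ≈ y → SameCoset G (Span G S) x y
  ≈⇒sameCoset {y = y} x≈y = resp (≈-trans (≈-sym (inverseˡ y)) (∙-congʳ (⁻¹-cong (≈-sym x≈y)))) unit

  schreier-≈ : ∀ {S A k} (χ : SchreierColorable G (Span G S) A k) {x y} →
               x ≈ y → proj₁ χ x ≡ proj₁ χ y
  schreier-≈ (_ , constant , _) {x} {y} x≈y = constant x y (≈⇒sameCoset x≈y)

  schreier-step-≢ : ∀ {S c k} (χ : SchreierColorable G (Span G S) (singleton G c) k) {x y} →
                    x ⁻¹ ∙ y ≈ c → proj₁ χ x ≢ proj₁ χ y
  schreier-step-≢ (_ , _ , proper) {x} {y} e =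
    proper x y (x , y , ≈⇒sameCoset ≈-refl , ≈⇒sameCoset ≈-refl , inj₁ (lift e))

module SumColouring {a ℓ} (G : Group a ℓ) {n} (f : Fin n → Group.Carrier G) {k}
  (χ : ∀ i → SchreierColorable G (Span G (remove G (image G f) (f i))) (singleton G (f i)) (suc k))
  where
  open Group G renaming (refl to ≈-refl; sym to ≈-sym; trans to ≈-trans)

  col : Fin n → Carrier → Fin (suc k)
  col i = proj₁ (χ i)

  col-≈ : ∀ {i x y} → x ≈ y → col i x ≡ col i y
  col-≈ {i} = schreier-≈ G {S = remove G (image G f) (f i)} {A = singleton G (f i)} (χ i)

  col-other : ∀ {i j x y} → x ⁻¹ ∙ y ≈ f j → ¬ f i ≈ f j → col i x ≡ col i y
  col-other {i} {j} {x} {y} e fi≉fj =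
    proj₁ (proj₂ (χ i)) x y (resp (≈-sym e) (gen (lift (j , ≈-refl) , fi≉fj ∘ ≈-sym)))

  -- f may list a generator several times and ≈ need not be decidable; the colourings
  -- themselves decide whether f i ≉ f j, which lets us count each generator once.
  Apart : Fin n → Fin n → Set
  Apart i j = col i ε ≡ col i (f j)

  apart? : ∀ i j → Dec (Apart i j)
  apart? i j = col i ε ≟ᶠ col i (f j)

  apart⇒≉ : ∀ {i j} → Apart i j → ¬ f i ≈ f j
  apart⇒≉ {i} {j} ap fi≈fj = schreier-step-≢ G (χ i) (≈-trans (ε⁻¹∙x≈x G (f j)) (≈-sym fi≈fj)) ap

  ≉⇒apart : ∀ {i j} → ¬ f i ≈ f j → Apart i j
  ≉⇒apart {j = j} = col-other (ε⁻¹∙x≈x G (f j))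

  apart-respʳ : ∀ {i j j'} → f j ≈ f j' → Apart i j → Apart i j'
  apart-respʳ fj≈fj' ap = trans ap (col-≈ fj≈fj')

  Leading : Fin n → Set
  Leading j = ∀ (t : Fin′ j) → Apart (inject t) j

  leading? : ∀ j → Dec (Leading j)
  leading? j = all? (λ t → apart? (inject t) j)

  leading-apart : ∀ {i j} → Leading j → i Fin.< j → Apart i j
  leading-apart {i} {j} Lj i<j = subst (λ t → Apart t j) (inject-lower i i<j) (Lj (lower i i<j))

  leading-unique : ∀ {i j} → Leading i → Leading j → f i ≈ f j → i ≡ j
  leading-unique {i} {j} Li Lj fi≈fj with <-cmp i j
  ... | tri< i<j _ _ = ⊥-elim (apart⇒≉ (leading-apart Lj i<j) fi≈fj)
  ... | tri≈ _ i≡j _ = i≡j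
  ... | tri> _ _ j<i = ⊥-elim (apart⇒≉ (leading-apart Li j<i) (≈-sym fi≈fj))

  leading-representative : ∀ j → ∃ λ i → Leading i × ¬ ¬ f i ≈ f j
  leading-representative j = i , decidable-stable (leading? i) ¬¬leading , ¬¬fi≈fj
    where
    smallest = ¬∀⟶∃¬-smallest n (λ i → Apart i j) (λ i → apart? i j) (λ all → apart⇒≉ (all j) ≈-refl)
    i = proj₁ smallest
    ¬¬fi≈fj : ¬ ¬ f i ≈ f j
    ¬¬fi≈fj fi≉fj = proj₁ (proj₂ smallest) (≉⇒apart fi≉fj)
    ¬¬leading : ¬ ¬ Leading i
    ¬¬leading ¬Li = ¬¬fi≈fj λ fi≈fj → ¬Li λ t → apart-respʳ (≈-sym fi≈fj) (proj₂ (proj₂ smallest) t)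

  summand : Carrier → Vector (Fin (suc k)) n
  summand x i = masked (leading? i) (col i x)

  colour : Carrier → Fin (suc k)
  colour x = sum (toℕ ∘ summand x) mod suc k

  colour-≈ : ∀ {x y} → x ≈ y → colour x ≡ colour y
  colour-≈ x≈y = cong (_mod suc k)
    (sum-cong-≗ λ i → cong (toℕ ∘ masked (leading? i)) (col-≈ x≈y))

  colour-step-≢ : ∀ {x y j} → x ⁻¹ ∙ y ≈ f j → colour x ≢ colour y
  colour-step-≢ {x} {y} {j} e with leading-representative j
  ... | i , Li , ¬¬fi≈fj = λ same → ¬¬fi≈fj λ fi≈fj →
    sum-mod-≢ (summand x) (summand y) i
      (masked-≢ (leading? i) Li (schreier-step-≢ G (χ i) (≈-trans e (≈-sym fi≈fj))))
      (λ i' i'≢i → masked-≡ (leading? i') λ Li' →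
        col-other e λ fi'≈fj → i'≢i (leading-unique Li' Li (≈-trans fi'≈fj (≈-sym fi≈fj))))
      same

  colour-proper : ∀ {x y} → CayAdj G (image G f) x y → colour x ≢ colour y
  colour-proper (inj₁ (lift (_ , e))) = colour-step-≢ e
  colour-proper (inj₂ (lift (_ , e))) = colour-step-≢ e ∘ sym

lemma2p3 : ∀ {a ℓ} (G : Group a ℓ) (n : ℕ) (f : Fin n → Group.Carrier G) →
    0 < n →
    MinimalGenerating G (image G f) →
    ∀ (k : ℕ) →
    (∀ (i : Fin n) →
       SchreierColorable G (Span G (remove G (image G f) (f i)))
         (singleton G (f i)) k) →
    CayColorable G (image G f) k
lemma2p3 G n f 0<n _ ℕ.zero χ = ⊥-elim (¬Fin0 (proj₁ (χ (fromℕ< 0<n)) (Group.ε G)))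
lemma2p3 G n f _ _ (suc k) χ = colour , (λ _ _ (lift x≈y) → colour-≈ x≈y) , λ _ _ → colour-proper
  where open SumColouring G f χ
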